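{- Let $G=(V,E)$ be a weighted graph, $F\subseteq E$ a forest, $N=E\setminus F$, and $S\supseteq \mathrm{end}(N)$ a set of terminals. Let $(G',F')=\mathrm{Contract}_S(G,F)$. Then $E(G')=N\,\dot\cup\,E(F')$ and $|E(G')|\le |N|+2|S|$.
   Context: $\mathrm{end}(E')$ is the set of endpoints of edges in $E'$. For a tree $T$ and terminal set $S\subseteq V(T)$, the connecting paths $\mathcal{P}_S(T)$ are the unique collection of paths in $T$ which are pairwise edge-disjoint, whose union is a connected subtree of $T$, such that every terminal is an endpoint of some path, and such that every endpoint of a path that is not in $S$ is an endpoint of at least two other paths of the collection. For a forest $F$ and set $S$, $\mathcal{P}_S(F)$ is the disjoint union over trees $T$ of $F$ of $\mathcal{P}_{S\cap V(T)}(T)$. The contracted (multi)graph $G'$ and contracted forest $F'$, written $(G',F')=\mathrm{Contract}_S(G,F)$, are obtained from $G$ and $F$ by (1) removing all edges of $F$ not lying on any path of $\mathcal{P}_S(F)$, and (2) replacing each connecting path $P_{uv}=(u,\dots,v)\in\mathcal{P}_S(F)$ by a single "super edge" $(u,v)$ of weight $\max_{e\in P_{uv}}w(e)$; edges of $N$ are kept. -}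

module Defs where

open import Data.Nat using (ℕ; zero; suc; _⊔_; _≤_; _+_; _*_)
open import Data.Bool using (Bool; true; false)
import Data.Bool.Properties as BoolP
open import Data.Fin using (Fin)
open import Data.Fin.Subset using (Subset; _∈_; _∉_)
open import Data.List using (List; []; _∷_; length; lookup; map; filter; foldr; allFin; _++_)
import Data.List.Membership.Propositional as LM
open import Data.List.Relation.Unary.Unique.Propositional using (Unique)
open import Data.Product using (Σ; ∃; ∃-syntax; _×_; _,_; proj₁; proj₂)
open import Data.Sum using (_⊎_)
open import Relation.Binary.PropositionalEquality using (_≡_; _≢_)
open import Relation.Nullary using (¬_)

-- Weighted (multi)graphs on the vertex set Fin n.
-- A graph is given by its list of edges; an edge is identified by its
-- position in the list (so parallel edges and multigraphs are allowed).

record Edge (n : ℕ) : Set where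
  constructor edge
  field
    src : Fin n
    tgt : Fin n
    wt  : ℕ
open Edge public

EIdx : ∀ {n} → List (Edge n) → Set
EIdx E = Fin (length E)

Joins : ∀ {n} → Edge n → Fin n → Fin n → Set
Joins e x y = (src e ≡ x × tgt e ≡ y) ⊎ (src e ≡ y × tgt e ≡ x)

data Walk {n} (E : List (Edge n)) (A : EIdx E → Set)
     : Fin n → Fin n → List (EIdx E) → List (Fin n) → Set where
  nil  : ∀ x → Walk E A x x [] (x ∷ [])
  cons : ∀ {x y z es vs} (i : EIdx E) → A i → Joins (lookup E i) x y →
         Walk E A y z es vs → Walk E A x z (i ∷ es) (x ∷ vs)

ConnectedIn : ∀ {n} (E : List (Edge n)) (A : EIdx E → Set) → Fin n → Fin n → Set
ConnectedIn E A x y = ∃[ es ] ∃[ vs ] Walk E A x y es vs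

-- The edge set F ⊆ E is given by a Boolean marker isF; N = E ∖ F.

InF : ∀ {n} (E : List (Edge n)) → (EIdx E → Bool) → EIdx E → Set
InF E isF i = isF i ≡ true

InN : ∀ {n} (E : List (Edge n)) → (EIdx E → Bool) → EIdx E → Set
InN E isF i = isF i ≡ false

IsForest : ∀ {n} (E : List (Edge n)) → (EIdx E → Bool) → Set
IsForest E isF = ∀ x es vs → Walk E (InF E isF) x x es vs → Unique es → es ≡ []

EndsInS : ∀ {n} (E : List (Edge n)) → (EIdx E → Bool) → Subset n → Set
EndsInS E isF S = ∀ i → InN E isF i → (src (lookup E i) ∈ S) × (tgt (lookup E i) ∈ S)

Nedges : ∀ {n} (E : List (Edge n)) → (EIdx E → Bool) → List (Edge n)
Nedges E isF = map (lookup E) (filter (λ i → isF i BoolP.≟ false) (allFin (length E)))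

record FPath {n} (E : List (Edge n)) (isF : EIdx E → Bool) : Set where
  field
    start : Fin n
    end   : Fin n
    es    : List (EIdx E)
    vs    : List (Fin n)
    walk  : Walk E (InF E isF) start end es vs
    distinctV : Unique vs
    nonempty  : es ≢ []
open FPath public

IsEndpoint : ∀ {n} {E : List (Edge n)} {isF : EIdx E → Bool} → Fin n → FPath E isF → Set
IsEndpoint x p = start p ≡ x ⊎ end p ≡ x

OnPaths : ∀ {n} {E : List (Edge n)} {isF : EIdx E → Bool} → List (FPath E isF) → EIdx E → Set
OnPaths P i = ∃[ a ] (i LM.∈ es (lookup P a))

-- P is the collection of connecting paths P_S(F): the disjoint union over
-- the trees T of F of P_{S ∩ V(T)}(T).
record IsConnectingPaths {n} (E : List (Edge n)) (isF : EIdx E → Bool)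
         (S : Subset n) (P : List (FPath E isF)) : Set where
  field
    edgeDisjoint : ∀ a b → a ≢ b → ∀ i → i LM.∈ es (lookup P a) → ¬ (i LM.∈ es (lookup P b))
    -- within each tree of F, the union of the paths is connected
    connected : ∀ a b → ConnectedIn E (InF E isF) (start (lookup P a)) (start (lookup P b)) →
                ConnectedIn E (OnPaths P) (start (lookup P a)) (start (lookup P b))
    -- every terminal is an endpoint of some path (in every tree of F
    -- containing at least two terminals)
    terminalsCovered : ∀ s → s ∈ S →
                (∃[ s' ] (s' ∈ S × s' ≢ s × ConnectedIn E (InF E isF) s s')) →
                ∃[ a ] IsEndpoint s (lookup P a)
    steiner : ∀ a x → IsEndpoint x (lookup P a) → x ∉ S →
                ∃[ b ] ∃[ c ] (a ≢ b × a ≢ c × b ≢ c ×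
                   IsEndpoint x (lookup P b) × IsEndpoint x (lookup P c))

maxW : List ℕ → ℕ
maxW = foldr _⊔_ 0

superEdge : ∀ {n} {E : List (Edge n)} {isF : EIdx E → Bool} → FPath E isF → Edge n
superEdge {E = E} p = edge (start p) (end p) (maxW (map (λ i → wt (lookup E i)) (es p)))

-- (G', F') = Contract_S(G, F), given the connecting paths P = P_S(F):
-- edges of F not on a connecting path are removed, each connecting path is
-- replaced by its super edge, and the edges of N are kept.
ContractF : ∀ {n} (E : List (Edge n)) (isF : EIdx E → Bool) → List (FPath E isF) → List (Edge n)
ContractF E isF P = map superEdge P

ContractG : ∀ {n} (E : List (Edge n)) (isF : EIdx E → Bool) → List (FPath E isF) → List (Edge n)
ContractG E isF P = Nedges E isF ++ map superEdge P

-- Only |P| ≤ 2|S| has content. The connecting paths are edge-disjoint, so a cycle of super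
-- edges would expand to a cycle of F: the super edges form a forest, and hence there are at
-- most as many of them as vertices X they touch. A touched vertex outside S has super-edge
-- degree at least 3 (the Steiner condition) and a touched terminal at least 1, so double
-- counting degrees gives 3X ≤ 2|P| + 2|S| ≤ 2X + 2|S|, whence |P| ≤ X ≤ 2|S|.
module Submission where

open import Defs
open import Data.Nat using (ℕ; _≤_; _+_; _*_)
open import Data.Bool using (Bool)
open import Data.Fin using (Fin)
open import Data.Fin.Subset using (Subset; ∣_∣)
open import Data.List using (List; length; _++_)
open import Data.Product using (_×_)
open import Relation.Binary.PropositionalEquality using (_≡_)

open import Data.Empty using (⊥-elim)
open import Data.Fin using (zero; suc; punchIn)
open import Data.Fin.Properties using (_≟_; punchInᵢ≢i)
open import Data.Fin.Subset using (inside; outside) renaming (_∉_ to _∉ˢ_)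
open import Data.Fin.Subset.Properties using (drop-there) renaming (_∈?_ to _∈ˢ?_)
open import Data.List using ([]; _∷_; lookup; map; allFin; concatMap)
open import Data.List.Membership.Propositional using (_∈_; _∉_; lose; find)
open import Data.List.Membership.Propositional.Properties using (∈-∃++)
open import Data.List.Properties using (++-conicalˡ; length-tabulate; length-++; length-map)
open import Data.List.Relation.Binary.Permutation.Propositional
  using (_↭_; ↭-refl; ↭-sym; ↭-trans; ↭-reflexive; ↭⇒↭ₛ)
open import Data.List.Relation.Binary.Permutation.Propositional.Properties
  using (shift; ↭-length; ∈-resp-↭; ++⁺; ++⁺ʳ; ++-comm; ↭-empty-inv)
import Data.List.Relation.Binary.Permutation.Setoid.Properties as PermSetoid
open import Data.List.Relation.Unary.All as All using (All; []; _∷_)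
import Data.List.Relation.Unary.All.Properties as All
open import Data.List.Relation.Unary.AllPairs as AllPairs using ([]; _∷_)
import Data.List.Relation.Unary.AllPairs.Properties as AllPairs
open import Data.List.Relation.Unary.Any using (Any; here; there; any?)
open import Data.List.Relation.Unary.Unique.Propositional using (Unique)
open import Data.List.Relation.Unary.Unique.Propositional.Properties
  using (Unique[x∷xs]⇒x∉xs; concat⁺; allFin⁺)
open import Data.Nat using (zero; suc; _<_; z≤n; s≤s)
open import Data.Nat.Induction using (<-wellFounded)
open import Data.Nat.Properties
  using ( +-*-semiring; ≤-refl; ≤-reflexive; ≤-trans; +-mono-≤; +-monoˡ-≤; +-monoʳ-≤
        ; +-mono-<-≤; +-mono-≤-<; *-monoʳ-≤; +-cancelʳ-≤; +-comm; *-comm; m≤m+n; module ≤-Reasoning)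
open import Algebra.Properties.Semiring.Sum +-*-semiring
  using (sum; sum-remove; sum-replicate-zero; ∑-distrib-+; ∑-comm; *-distribˡ-sum)
open import Data.Product using (∃-syntax; _,_)
open import Data.Sum using (_⊎_; inj₁; inj₂)
open import Data.Unit using (⊤; tt)
open import Data.Vec using ([]; _∷_)
open import Function using (_∘_)
open import Induction.WellFounded using (Acc; acc)
open import Relation.Binary.Definitions using (DecidableEquality)
open import Relation.Binary.PropositionalEquality using (_≢_; refl; cong; sym; subst; setoid)
open import Relation.Nullary using (¬_; Dec; yes; no; ¬?)
open import Relation.Nullary.Decidable using (_⊎-dec_; _×-dec_; decidable-stable)
open import Relation.Unary using (Pred; Decidable; _⊆_)

𝟙 : ∀ {p} {P : Set p} → Dec P → ℕ
𝟙 (yes _) = 1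
𝟙 (no _)  = 0

𝟙≤1 : ∀ {p} {P : Set p} (P? : Dec P) → 𝟙 P? ≤ 1
𝟙≤1 (yes _) = ≤-refl
𝟙≤1 (no _)  = z≤n

𝟙-mono : ∀ {p q} {P : Set p} {Q : Set q} → (P → Q) → (P? : Dec P) (Q? : Dec Q) → 𝟙 P? ≤ 𝟙 Q?
𝟙-mono P⇒Q (yes _) (yes _) = ≤-refl
𝟙-mono P⇒Q (yes p) (no ¬q) = ⊥-elim (¬q (P⇒Q p))
𝟙-mono P⇒Q (no _)  _       = z≤n

𝟙-⊎ : ∀ {p q r} {P : Set p} {Q : Set q} {R : Set r} → (P → Q ⊎ R) →
      (P? : Dec P) (Q? : Dec Q) (R? : Dec R) → 𝟙 P? ≤ 𝟙 Q? + 𝟙 R?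
𝟙-⊎ P⇒Q⊎R (no _)  Q?      R?      = z≤n
𝟙-⊎ P⇒Q⊎R (yes _) (yes _) R?      = s≤s z≤n
𝟙-⊎ P⇒Q⊎R (yes _) (no _)  (yes _) = s≤s z≤n
𝟙-⊎ P⇒Q⊎R (yes p) (no ¬q) (no ¬r) with P⇒Q⊎R p
... | inj₁ q = ⊥-elim (¬q q)
... | inj₂ r = ⊥-elim (¬r r)

sum-mono-≤ : ∀ {n} {f g : Fin n → ℕ} → (∀ i → f i ≤ g i) → sum f ≤ sum g
sum-mono-≤ {zero}  f≤g = z≤n
sum-mono-≤ {suc n} f≤g = +-mono-≤ (f≤g zero) (sum-mono-≤ (f≤g ∘ suc))

sum-mono-< : ∀ {n} {f g : Fin n → ℕ} → (∀ i → f i ≤ g i) → ∀ j → f j < g j → sum f < sum g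
sum-mono-< f≤g zero    fj<gj = +-mono-<-≤ fj<gj (sum-mono-≤ (f≤g ∘ suc))
sum-mono-< f≤g (suc j) fj<gj = +-mono-≤-< (f≤g zero) (sum-mono-< (f≤g ∘ suc) j fj<gj)

sum-const : ∀ n c → sum {n} (λ _ → c) ≡ n * c
sum-const zero    c = refl
sum-const (suc n) c = cong (c +_) (sum-const n c)

_∈?_ : ∀ {n} (x : Fin n) (xs : List (Fin n)) → Dec (x ∈ xs)
x ∈? xs = any? (x ≟_) xs

count : ∀ {n p} {P : Pred (Fin n) p} → Decidable P → ℕ
count P? = sum (λ i → 𝟙 (P? i))

module _ {n p q} {P : Pred (Fin n) p} {Q : Pred (Fin n) q} (P? : Decidable P) (Q? : Decidable Q) where

  count-mono : P ⊆ Q → count P? ≤ count Q?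
  count-mono P⊆Q = sum-mono-≤ (λ i → 𝟙-mono P⊆Q (P? i) (Q? i))

  count-mono-< : P ⊆ Q → ∀ {i} → Q i → ¬ P i → count P? < count Q?
  count-mono-< P⊆Q {i} qi ¬pi = sum-mono-< (λ j → 𝟙-mono P⊆Q (P? j) (Q? j)) i (lemma (P? i) (Q? i))
    where
    lemma : (P?ᵢ : Dec (P i)) (Q?ᵢ : Dec (Q i)) → 𝟙 P?ᵢ < 𝟙 Q?ᵢ
    lemma (yes pi) _        = ⊥-elim (¬pi pi)
    lemma (no _)   (yes _)  = s≤s z≤n
    lemma (no _)   (no ¬qi) = ⊥-elim (¬qi qi)

  count-⊎ : ∀ {r} {R : Pred (Fin n) r} (R? : Decidable R) →
            (∀ {i} → R i → P i ⊎ Q i) → count R? ≤ count P? + count Q?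
  count-⊎ R? R⊆P∪Q = begin
    count R?                              ≤⟨ sum-mono-≤ (λ i → 𝟙-⊎ R⊆P∪Q (R? i) (P? i) (Q? i)) ⟩
    sum (λ i → 𝟙 (P? i) + 𝟙 (Q? i))       ≡⟨ ∑-distrib-+ (λ i → 𝟙 (P? i)) (λ i → 𝟙 (Q? i)) ⟩
    count P? + count Q?                   ∎
    where open ≤-Reasoning

count-≟≤1 : ∀ {n} (s : Fin n) → count (s ≟_) ≤ 1
count-≟≤1 {suc n} s = begin
  count (s ≟_)                                   ≡⟨ sum-remove {i = s} (λ i → 𝟙 (s ≟ i)) ⟩
  𝟙 (s ≟ s) + sum (λ i → 𝟙 (s ≟ punchIn s i))    ≤⟨ +-mono-≤ (𝟙≤1 (s ≟ s)) (sum-mono-≤ s≢punchIn) ⟩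
  1 + sum {n} (λ _ → 0)                          ≡⟨ cong (1 +_) (sum-replicate-zero n) ⟩
  1                                              ∎
  where
  open ≤-Reasoning
  s≢punchIn : ∀ i → 𝟙 (s ≟ punchIn s i) ≤ 0
  s≢punchIn i = 𝟙-mono (punchInᵢ≢i s i ∘ sym) (s ≟ punchIn s i) (no λ ())

length≤count-∈ : ∀ {n} {xs : List (Fin n)} → Unique xs → length xs ≤ count (_∈? xs)
length≤count-∈ {xs = []}     _             = z≤n
length≤count-∈ {xs = x ∷ xs} !x∷xs@(_ ∷ !xs) =
  ≤-trans (s≤s (length≤count-∈ !xs))
          (count-mono-< (_∈? xs) (_∈? (x ∷ xs)) there (here refl) (Unique[x∷xs]⇒x∉xs !x∷xs))

length≤count : ∀ {n p} {P : Pred (Fin n) p} (P? : Decidable P) {xs} →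
               Unique xs → All P xs → length xs ≤ count P?
length≤count P? {xs} !xs all = ≤-trans (length≤count-∈ !xs) (count-mono (_∈? xs) P? (All.lookup all))

count-∈≤∣∣ : ∀ {n} (S : Subset n) → count (_∈ˢ? S) ≤ ∣ S ∣
count-∈≤∣∣ []            = z≤n
count-∈≤∣∣ (inside  ∷ S) = s≤s (≤-trans (count-mono _ (_∈ˢ? S) drop-there) (count-∈≤∣∣ S))
count-∈≤∣∣ (outside ∷ S) = ≤-trans (count-mono _ (_∈ˢ? S) drop-there) (count-∈≤∣∣ S)

Unique-resp-↭ : ∀ {A : Set} {xs ys : List A} → xs ↭ ys → Unique xs → Unique ys
Unique-resp-↭ {A} σ = PermSetoid.Unique-resp-↭ (setoid A) (↭⇒↭ₛ σ)

Touches : ∀ {n} → Edge n → Fin n → Set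
Touches e u = src e ≡ u ⊎ tgt e ≡ u

module _ {n} (e : Edge n) where

  Joins-sym : ∀ {x y} → Joins e x y → Joins e y x
  Joins-sym (inj₁ x-y) = inj₂ x-y
  Joins-sym (inj₂ y-x) = inj₁ y-x

  Joins⇒Touchesˡ : ∀ {x y} → Joins e x y → Touches e x
  Joins⇒Touchesˡ (inj₁ (refl , _)) = inj₁ refl
  Joins⇒Touchesˡ (inj₂ (_ , refl)) = inj₂ refl

  Joins⇒Touchesʳ : ∀ {x y} → Joins e x y → Touches e y
  Joins⇒Touchesʳ = Joins⇒Touchesˡ ∘ Joins-sym

  Touches⇒Joins : ∀ {u} → Touches e u → ∃[ w ] Joins e u w
  Touches⇒Joins (inj₁ refl) = tgt e , inj₁ (refl , refl)
  Touches⇒Joins (inj₂ refl) = src e , inj₂ (refl , refl)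

  Joins-Touches⇒≡⊎≡ : ∀ {x y u} → Joins e x y → Touches e u → u ≡ x ⊎ u ≡ y
  Joins-Touches⇒≡⊎≡ (inj₁ (refl , refl)) (inj₁ refl) = inj₁ refl
  Joins-Touches⇒≡⊎≡ (inj₁ (refl , refl)) (inj₂ refl) = inj₂ refl
  Joins-Touches⇒≡⊎≡ (inj₂ (refl , refl)) (inj₁ refl) = inj₂ refl
  Joins-Touches⇒≡⊎≡ (inj₂ (refl , refl)) (inj₂ refl) = inj₁ refl

touches? : ∀ {n} (e : Edge n) → Decidable (Touches e)
touches? e u = (src e ≟ u) ⊎-dec (tgt e ≟ u)

module Multigraph {n} {I : Set} (_≟ᴵ_ : DecidableEquality I) (ends : I → Edge n) where

  data MWalk : Fin n → Fin n → List I → List (Fin n) → Set where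
    nil  : ∀ x → MWalk x x [] (x ∷ [])
    cons : ∀ {x y z es vs} i → Joins (ends i) x y → MWalk y z es vs → MWalk x z (i ∷ es) (x ∷ vs)

  Incident : I → Fin n → Set
  Incident i = Touches (ends i)

  Cycle : Set
  Cycle = ∃[ x ] ∃[ es ] ∃[ vs ] MWalk x x es vs × Unique es × es ≢ []

  Leaf : List I → Set
  Leaf L = ∃[ e ] ∃[ u ] e ∈ L × Incident e u × (∀ {b} → b ∈ L → Incident b u → b ≡ e)

  HeadIs : I → List I → Set
  HeadIs e []      = ⊤
  HeadIs e (h ∷ _) = h ≡ e

  start∈ : ∀ {x z es vs} → MWalk x z es vs → x ∈ vs
  start∈ (nil x)       = here refl
  start∈ (cons _ _ _)  = here refl

  end∈ : ∀ {x z es vs} → MWalk x z es vs → z ∈ vs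
  end∈ (nil x)      = here refl
  end∈ (cons _ _ W) = there (end∈ W)

  incident∈vertices : ∀ {x z es vs i u} → i ∈ es → MWalk x z es vs → Incident i u → u ∈ vs
  incident∈vertices (here refl) (cons i x-y W) i∼u with Joins-Touches⇒≡⊎≡ (ends i) x-y i∼u
  ... | inj₁ refl = here refl
  ... | inj₂ refl = there (start∈ W)
  incident∈vertices (there i∈es) (cons _ _ W) i∼u = there (incident∈vertices i∈es W i∼u)

  distinct-edges : ∀ {x z es vs} → MWalk x z es vs → Unique vs → Unique es
  distinct-edges (nil x)                  _              = []
  distinct-edges (cons {es = es} i x-y W) !vs′@(_ ∷ !vs) = All.¬Any⇒All¬ es i∉es ∷ distinct-edges W !vs
    where
    i∉es : i ∉ es
    i∉es i∈es = Unique[x∷xs]⇒x∉xs !vs′ (incident∈vertices i∈es W (Joins⇒Touchesˡ (ends i) x-y))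

  closed⇒trivial : ∀ {x es vs} → MWalk x x es vs → Unique vs → es ≡ []
  closed⇒trivial (nil x)      _    = refl
  closed⇒trivial (cons _ _ W) !vs′ = ⊥-elim (Unique[x∷xs]⇒x∉xs !vs′ (end∈ W))

  chord⇒single : ∀ {x z es vs e} → MWalk x z es vs → Unique vs → e ∈ es → Joins (ends e) x z →
                 es ≡ e ∷ []
  chord⇒single (cons i x-y W) !vs′@(_ ∷ !vs) (here refl) x-z
    with Joins-Touches⇒≡⊎≡ (ends i) x-z (Joins⇒Touchesʳ (ends i) x-y)
  ... | inj₁ refl = ⊥-elim (Unique[x∷xs]⇒x∉xs !vs′ (start∈ W))
  ... | inj₂ refl = cong (i ∷_) (closed⇒trivial W !vs)
  chord⇒single {e = e} (cons _ _ W) !vs′ (there e∈es) x-z =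
    ⊥-elim (Unique[x∷xs]⇒x∉xs !vs′ (incident∈vertices e∈es W (Joins⇒Touchesˡ (ends e) x-z)))

  prefix : ∀ {x z es vs w} → MWalk x z es vs → Unique vs → w ∈ vs →
           ∃[ es′ ] ∃[ vs′ ] MWalk x w es′ vs′ × Unique vs′ × (∀ {v} → v ∈ vs′ → v ∈ vs)
             × (∀ {e} → HeadIs e es → HeadIs e es′)
  prefix (nil x)               _ (here refl) = [] , x ∷ [] , nil x , [] ∷ [] , (λ v∈ → v∈) , λ _ → tt
  prefix (cons {x = x} _ _ _) _ (here refl) =
    [] , x ∷ [] , nil x , [] ∷ [] , (λ { (here refl) → here refl }) , λ _ → tt
  prefix (cons i x-y W) !vs′@(_ ∷ !vs) (there w∈vs) with prefix W !vs w∈vs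
  ... | es′ , vs′ , W′ , !vs″ , vs″⊆vs , _ =
    i ∷ es′ , _ ∷ vs′ , cons i x-y W′ ,
    All.¬Any⇒All¬ vs′ (Unique[x∷xs]⇒x∉xs !vs′ ∘ vs″⊆vs) ∷ !vs″ ,
    (λ { (here refl) → here refl ; (there v∈) → there (vs″⊆vs v∈) }) , λ i≡e → i≡e

  closing-cycle : ∀ {v w es vs e b} → MWalk v w es vs → Unique vs → HeadIs e es → b ≢ e →
                  Joins (ends b) v w → Cycle
  closing-cycle {w = w} {es} {vs} {e} {b} W !vs hd b≢e v-w =
    w , b ∷ es , w ∷ vs , cons b (Joins-sym (ends b) v-w) W ,
    All.¬Any⇒All¬ es b∉es ∷ distinct-edges W !vs , λ ()
    where
    b∉es : b ∉ es
    b∉es b∈es = b≢e (subst (HeadIs e) (chord⇒single W !vs b∈es v-w) hd)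

  unvisited : List (Fin n) → ℕ
  unvisited vs = count (λ u → ¬? (u ∈? vs))

  unvisited-∷ : ∀ {w vs} → w ∉ vs → unvisited (w ∷ vs) < unvisited vs
  unvisited-∷ {w} {vs} w∉vs =
    count-mono-< (λ u → ¬? (u ∈? (w ∷ vs))) (λ u → ¬? (u ∈? vs))
                 (λ u∉ u∈ → u∉ (there u∈)) w∉vs (λ w∉ → w∉ (here refl))

  incident? : ∀ i → Decidable (Incident i)
  incident? i = touches? (ends i)

  -- Grow a vertex-simple walk backwards from its first edge e at v: either e is the only edge
  -- of L at v, or another edge of L leads back onto the walk (a cycle) or to a new vertex
  -- (fewer unvisited vertices).
  leaf-search : ∀ L {v v₀ e es vs} → Acc _<_ (unvisited vs) → e ∈ L → Incident e v → HeadIs e es →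
                MWalk v v₀ es vs → Unique vs → Leaf L ⊎ Cycle
  leaf-search L {v} {e = e} {vs = vs} (acc rec) e∈L e∼v hd W !vs
    with any? (λ b → ¬? (b ≟ᴵ e) ×-dec incident? b v) L
  ... | no noOther = inj₁ (e , v , e∈L , e∼v , only-e)
    where
    only-e : ∀ {b} → b ∈ L → Incident b v → b ≡ e
    only-e {b} b∈L b∼v = decidable-stable (b ≟ᴵ e) (λ b≢e → noOther (lose b∈L (b≢e , b∼v)))
  ... | yes other with find other
  ... | b , b∈L , b≢e , b∼v with Touches⇒Joins (ends b) b∼v
  ... | w , v-w with w ∈? vs
  ... | yes w∈vs = let _ , _ , W′ , !vs′ , _ , hd′ = prefix W !vs w∈vs
                   in  inj₂ (closing-cycle W′ !vs′ (hd′ hd) b≢e v-w)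
  ... | no  w∉vs = leaf-search L (rec (unvisited-∷ w∉vs)) b∈L (Joins⇒Touchesʳ (ends b) v-w) refl
                     (cons b (Joins-sym (ends b) v-w) W) (All.¬Any⇒All¬ vs w∉vs ∷ !vs)

  leaf-or-cycle : ∀ {L} → L ≢ [] → Leaf L ⊎ Cycle
  leaf-or-cycle {[]}    L≢[] = ⊥-elim (L≢[] refl)
  leaf-or-cycle {a ∷ L} _    =
    leaf-search (a ∷ L) (<-wellFounded _) (here refl) (inj₁ refl) tt (nil (src (ends a))) ([] ∷ [])

  Covered : List I → Fin n → Set
  Covered L u = Any (λ a → Incident a u) L

  covered? : ∀ L → Decidable (Covered L)
  covered? L u = any? (λ a → incident? a u) L

  Covered-mono : ∀ {L L′} → (∀ {a} → a ∈ L′ → a ∈ L) → Covered L′ ⊆ Covered L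
  Covered-mono L′⊆L c = let _ , a∈L′ , a∼u = find c in lose (L′⊆L a∈L′) a∼u

  edges≤covered : ¬ Cycle → ∀ {L} → Unique L → length L ≤ count (covered? L)
  edges≤covered acyclic = go (<-wellFounded _)
    where
    go : ∀ {L} → Acc _<_ (length L) → Unique L → length L ≤ count (covered? L)
    go {[]}        _         _  = z≤n
    go {L@(_ ∷ _)} (acc rec) !L with leaf-or-cycle {L} (λ ())
    ... | inj₂ cycle = ⊥-elim (acyclic cycle)
    ... | inj₁ (e , u , e∈L , e∼u , only-e) with ∈-∃++ e∈L
    ... | ys , zs , L≡ys++e∷zs = begin
      length L                    ≡⟨ ↭-length σ ⟩
      suc (length L′)             ≤⟨ s≤s (go (rec (≤-reflexive (sym (↭-length σ)))) !L′) ⟩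
      suc (count (covered? L′))   ≤⟨ count-mono-< (covered? L′) (covered? L) (Covered-mono L′⊆L)
                                                  (lose e∈L e∼u) u∉L′ ⟩
      count (covered? L)          ∎
      where
      open ≤-Reasoning
      L′ = ys ++ zs
      σ : L ↭ e ∷ L′
      σ = ↭-trans (↭-reflexive L≡ys++e∷zs) (shift e ys zs)
      !eL′ : Unique (e ∷ L′)
      !eL′ = Unique-resp-↭ σ !L
      !L′ : Unique L′
      !L′ with _ ∷ !L′ ← !eL′ = !L′
      L′⊆L : ∀ {a} → a ∈ L′ → a ∈ L
      L′⊆L a∈L′ = ∈-resp-↭ (↭-sym σ) (there a∈L′)
      u∉L′ : ¬ Covered L′ u
      u∉L′ c with _ , b∈L′ , b∼u ← find c =
        Unique[x∷xs]⇒x∉xs !eL′ (subst (_∈ L′) (only-e (L′⊆L b∈L′) b∼u) b∈L′)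

module _ {n} {E : List (Edge n)} {A : EIdx E → Set} where

  _++ʷ_ : ∀ {x y z es es′ vs vs′} → Walk E A x y es vs → Walk E A y z es′ vs′ →
          ∃[ vs″ ] Walk E A x z (es ++ es′) vs″
  nil _          ++ʷ W′ = _ , W′
  cons i a x-y W ++ʷ W′ = let _ , W″ = W ++ʷ W′ in _ , cons i a x-y W″

  reverseʷ : ∀ {x z es vs} → Walk E A x z es vs → ∃[ es′ ] ∃[ vs′ ] Walk E A z x es′ vs′ × es′ ↭ es
  reverseʷ (nil x) = [] , _ , nil x , ↭-refl
  reverseʷ {x = x} (cons {es = es} i a x-y W) with reverseʷ W
  ... | es′ , _ , W′ , es′↭es with W′ ++ʷ cons i a (Joins-sym (lookup E i) x-y) (nil x)
  ... | _ , W″ = es′ ++ i ∷ [] , _ , W″ , ↭-trans (++⁺ʳ (i ∷ []) es′↭es) (++-comm es (i ∷ []))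

  forget : ∀ {x z es vs} → Walk E A x z es vs → Multigraph.MWalk _≟_ (lookup E) x z es vs
  forget (nil x)          = Multigraph.nil x
  forget (cons i _ x-y W) = Multigraph.cons i x-y (forget W)

FPath-edges-unique : ∀ {n} {E : List (Edge n)} {isF} (p : FPath E isF) → Unique (es p)
FPath-edges-unique p = Multigraph.distinct-edges _≟_ _ (forget (walk p)) (distinctV p)

count-touches≤2 : ∀ {n} (e : Edge n) → count (touches? e) ≤ 2
count-touches≤2 e = ≤-trans (count-⊎ (src e ≟_) (tgt e ≟_) (touches? e) (λ t → t))
                            (+-mono-≤ (count-≟≤1 (src e)) (count-≟≤1 (tgt e)))

m≤x∧3x≤2m+2t⇒m≤2t : ∀ {m x t} → m ≤ x → 3 * x ≤ 2 * m + 2 * t → m ≤ 2 * t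
-- 3 * x unfolds to x + 2 * x, the left side expected by +-cancelʳ-≤.
m≤x∧3x≤2m+2t⇒m≤2t {m} {x} {t} m≤x 3x≤2m+2t = ≤-trans m≤x (+-cancelʳ-≤ (2 * x) x (2 * t) (begin
  3 * x            ≤⟨ 3x≤2m+2t ⟩
  2 * m + 2 * t    ≤⟨ +-monoˡ-≤ (2 * t) (*-monoʳ-≤ 2 m≤x) ⟩
  2 * x + 2 * t    ≡⟨ +-comm (2 * x) (2 * t) ⟩
  2 * t + 2 * x    ∎))
  where open ≤-Reasoning

module SuperEdges {n} {E : List (Edge n)} {isF : EIdx E → Bool} (P : List (FPath E isF)) where

  pathEdges : Fin (length P) → List (EIdx E)
  pathEdges a = es (lookup P a)

  open Multigraph _≟_ (superEdge ∘ lookup P)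

  superEdge-walk : ∀ a {x y} → Joins (superEdge (lookup P a)) x y →
                   ∃[ es′ ] ∃[ vs ] Walk E (InF E isF) x y es′ vs × es′ ↭ pathEdges a
  superEdge-walk a (inj₁ (refl , refl)) = _ , _ , walk (lookup P a) , ↭-refl
  superEdge-walk a (inj₂ (refl , refl)) = reverseʷ (walk (lookup P a))

  expand : ∀ {x z as vs} → MWalk x z as vs →
           ∃[ es′ ] ∃[ vs′ ] Walk E (InF E isF) x z es′ vs′ × es′ ↭ concatMap pathEdges as
  expand (nil x) = [] , _ , nil x , ↭-refl
  expand (cons a x-y W) with superEdge-walk a x-y | expand W
  ... | es₁ , _ , W₁ , σ₁ | es₂ , _ , W₂ , σ₂ with W₁ ++ʷ W₂
  ... | _ , W = es₁ ++ es₂ , _ , W , ++⁺ σ₁ σ₂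

  EdgeDisjoint : Set
  EdgeDisjoint = ∀ a b → a ≢ b → ∀ i → i ∈ pathEdges a → ¬ i ∈ pathEdges b

  module _ (edgeDisjoint : EdgeDisjoint) where

    concatMap-unique : ∀ {as} → Unique as → Unique (concatMap pathEdges as)
    concatMap-unique !as = concat⁺
      (All.map⁺ (All.tabulate (λ {a} _ → FPath-edges-unique (lookup P a))))
      (AllPairs.map⁺ {f = pathEdges}
        (AllPairs.map (λ a≢b {i} (i∈a , i∈b) → edgeDisjoint _ _ a≢b i i∈a i∈b) !as))

    acyclic : IsForest E isF → ¬ Cycle
    acyclic forest (_ , [] , _ , _ , _ , as≢[]) = as≢[] refl
    acyclic forest (x , a ∷ as , _ , W , !as , _) with expand W
    ... | es′ , vs′ , W′ , σ =
      nonempty (lookup P a) (++-conicalˡ (pathEdges a) _ (↭-empty-inv concat↭[]))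
      where
      concat↭[] : concatMap pathEdges (a ∷ as) ↭ []
      concat↭[] = subst (concatMap pathEdges (a ∷ as) ↭_)
                        (forest x es′ vs′ W′ (Unique-resp-↭ (↭-sym σ) (concatMap-unique !as)))
                        (↭-sym σ)

  degree : Fin n → ℕ
  degree u = count (λ a → incident? a u)

  degree-sum : sum degree ≤ 2 * length P
  degree-sum = begin
    sum degree                        ≡⟨ ∑-comm (λ u a → 𝟙 (incident? a u)) ⟩
    sum (λ a → count (incident? a))   ≤⟨ sum-mono-≤ (λ a → count-touches≤2 (superEdge (lookup P a))) ⟩
    sum {length P} (λ _ → 2)          ≡⟨ sum-const (length P) 2 ⟩
    length P * 2                      ≡⟨ *-comm (length P) 2 ⟩
    2 * length P                      ∎
    where open ≤-Reasoning

  touched? : Decidable (Covered (allFin (length P)))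
  touched? = covered? (allFin (length P))

  length≤touched : IsForest E isF → EdgeDisjoint → length P ≤ count touched?
  length≤touched forest edgeDisjoint =
    subst (_≤ count touched?) (length-tabulate (λ a → a))
          (edges≤covered (acyclic edgeDisjoint forest) (allFin⁺ (length P)))

  module _ (S : Subset n)
           (steiner : ∀ a x → IsEndpoint x (lookup P a) → x ∉ˢ S →
                      ∃[ b ] ∃[ c ] (a ≢ b × a ≢ c × b ≢ c ×
                                     IsEndpoint x (lookup P b) × IsEndpoint x (lookup P c)))
           where

    touched-vertex-bound : ∀ u → 3 * 𝟙 (touched? u) ≤ degree u + 2 * 𝟙 (u ∈ˢ? S)
    touched-vertex-bound u with touched? u
    ... | no _  = z≤n
    ... | yes t with find t | u ∈ˢ? S
    ... | a , _ , a∼u | yes _ =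
      +-monoˡ-≤ 2 (length≤count (λ b → incident? b u) {a ∷ []} ([] ∷ []) (a∼u ∷ []))
    ... | a , _ , a∼u | no u∉S with steiner a u a∼u u∉S
    ... | b , c , a≢b , a≢c , b≢c , b∼u , c∼u =
      ≤-trans (length≤count (λ b → incident? b u) {a ∷ b ∷ c ∷ []}
                            ((a≢b ∷ a≢c ∷ []) ∷ (b≢c ∷ []) ∷ [] ∷ []) (a∼u ∷ b∼u ∷ c∼u ∷ []))
              (m≤m+n (degree u) 0)

    touched-count-bound : 3 * count touched? ≤ 2 * length P + 2 * count (_∈ˢ? S)
    touched-count-bound = begin
      3 * count touched?                        ≡⟨ *-distribˡ-sum 3 (λ u → 𝟙 (touched? u)) ⟩
      sum (λ u → 3 * 𝟙 (touched? u))            ≤⟨ sum-mono-≤ touched-vertex-bound ⟩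
      sum (λ u → degree u + 2 * 𝟙 (u ∈ˢ? S))    ≡⟨ ∑-distrib-+ degree (λ u → 2 * 𝟙 (u ∈ˢ? S)) ⟩
      sum degree + sum (λ u → 2 * 𝟙 (u ∈ˢ? S))  ≡⟨ cong (sum degree +_) (sym (*-distribˡ-sum 2 (λ u → 𝟙 (u ∈ˢ? S)))) ⟩
      sum degree + 2 * count (_∈ˢ? S)           ≤⟨ +-monoˡ-≤ _ degree-sum ⟩
      2 * length P + 2 * count (_∈ˢ? S)         ∎
      where open ≤-Reasoning

    length≤2∣S∣ : IsForest E isF → EdgeDisjoint → length P ≤ 2 * ∣ S ∣
    length≤2∣S∣ forest edgeDisjoint = ≤-trans
      (m≤x∧3x≤2m+2t⇒m≤2t {t = count (_∈ˢ? S)} (length≤touched forest edgeDisjoint) touched-count-bound)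
      (*-monoʳ-≤ 2 (count-∈≤∣∣ S))

proposition7p16 : ∀ {n} (E : List (Edge n)) (isF : Fin (length E) → Bool) (S : Subset n) →
    IsForest E isF → EndsInS E isF S →
    (P : List (FPath E isF)) → IsConnectingPaths E isF S P →
    (ContractG E isF P ≡ Nedges E isF ++ ContractF E isF P)
    × (length (ContractG E isF P) ≤ length (Nedges E isF) + 2 * ∣ S ∣)
proposition7p16 E isF S forest _ P CP = refl , (begin
  length (Nedges E isF ++ map superEdge P)          ≡⟨ length-++ (Nedges E isF) ⟩
  length (Nedges E isF) + length (map superEdge P)  ≡⟨ cong (length (Nedges E isF) +_) (length-map superEdge P) ⟩
  length (Nedges E isF) + length P                  ≤⟨ +-monoʳ-≤ _ (length≤2∣S∣ S steiner forest edgeDisjoint) ⟩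
  length (Nedges E isF) + 2 * ∣ S ∣                 ∎)
  where
  open ≤-Reasoning
  open IsConnectingPaths CP
  open SuperEdges P
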